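{- Let $m,n$ be positive integers, not both equal to $1$. Then the grid graph $P_n \square P_m$ is factorable if and only if both $m$ and $n$ are even.
   Context: $P_k$ is the path on $k$ vertices and $\square$ is the Cartesian product of graphs. All graphs are finite, simple and undirected. A graph $G$ is factorable if there exist graphs $H,K$ on the vertex set $V(G)$ with $A=BC$, where $A,B,C$ are the adjacency matrices of $G,H,K$ with respect to one common ordering of the vertices. -}

module Defs where

open import Data.Nat using (ℕ; zero; suc; _+_; _*_; _≡ᵇ_)
open import Data.Bool using (Bool; true; false; _∨_; _∧_; not)
open import Data.Fin using (Fin; toℕ; zero; suc)
open import Data.Product using (_×_; _,_; Σ; ∃)
open import Relation.Binary.PropositionalEquality using (_≡_)

∑ : (n : ℕ) → (Fin n → ℕ) → ℕ
∑ zero    f = 0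
∑ (suc n) f = f zero + ∑ n (λ i → f (suc i))

Vtx : ℕ → ℕ → Set
Vtx n m = Fin n × Fin m

∑V : (n m : ℕ) → (Vtx n m → ℕ) → ℕ
∑V n m f = ∑ n (λ i → ∑ m (λ j → f (i , j)))

record SimpleGraph (V : Set) : Set where
  field
    adj   : V → V → Bool
    sym   : ∀ u v → adj u v ≡ adj v u
    irrefl : ∀ v → adj v v ≡ false
open SimpleGraph public

entry : Bool → ℕ
entry true  = 1
entry false = 0

pathAdj : {k : ℕ} → Fin k → Fin k → Bool
pathAdj a b = (suc (toℕ a) ≡ᵇ toℕ b) ∨ (suc (toℕ b) ≡ᵇ toℕ a)

gridAdj : (n m : ℕ) → Vtx n m → Vtx n m → Bool
gridAdj n m (i , j) (i' , j') =
  ((toℕ i ≡ᵇ toℕ i') ∧ pathAdj j j') ∨ ((toℕ j ≡ᵇ toℕ j') ∧ pathAdj i i')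

-- G (on V = Vtx n m) is factorable: there are simple graphs H, K on V(G)
-- with A = B C, A, B, C the adjacency matrices w.r.t. a common ordering
-- (the matrix product written out entrywise over ℕ).
Factorable : (n m : ℕ) → (Vtx n m → Vtx n m → Bool) → Set
Factorable n m A =
  Σ (SimpleGraph (Vtx n m)) λ H → Σ (SimpleGraph (Vtx n m)) λ K →
    ∀ u v → entry (A u v) ≡ ∑V n m (λ w → entry (adj H u w) * entry (adj K w v))

Even : ℕ → Set
Even k = ∃ λ t → k ≡ t + t

module Submission where

-- If G = H K for simple graphs H, K, then deg G u = deg H u · deg K u, deg K is constant
-- along H-edges and deg H along K-edges, so every edge v u of G yields a vertex of degree
-- deg H u · deg K v.  On a grid or path other than P₁ these constraints force deg H ≡ 1
-- or deg K ≡ 1: one factor is a perfect matching u ↦ σ u, and σ is then a fixed-point-free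
-- involutive automorphism of G with u ≁ σ u.  Such a σ pairs up the vertices, so n m is
-- even, and pairs up the edges so that their number is even, i.e.
-- 4 ∣ 2 m (n - 1) + 2 n (m - 1); together these force n and m to be even.  Conversely,
-- for n and m even the reflection (i , j) ↦ (n - 1 - i , m - 1 - j) is such a σ, and
-- G = H K with H the matching {u , σ u} and K = G ∘ σ.

open import Defs hiding (sym)
open import Data.Nat using (ℕ; _≥_)
open import Data.Product using (_×_)
open import Function.Bundles using (_⇔_)
open import Relation.Binary.PropositionalEquality using (_≡_)
open import Relation.Nullary using (¬_)

import Algebra.Properties.Semiring.Sum
open import Data.Bool using (true; false; _∨_; _∧_)
open import Data.Bool.Properties using (T-≡; ∨-comm; ∨-zeroʳ; ∧-zeroʳ; ∧-conicalˡ)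
open import Data.Empty using (⊥-elim)
open import Data.Fin using (Fin; zero; suc; toℕ; inject₁; combine; opposite)
open import Data.Fin.Induction using (<-weakInduction)
import Data.Fin.Properties as Fin
open import Data.Nat using (zero; suc; _+_; _*_; _∸_; _≤_; _<_; z≤n; s≤s; _≡ᵇ_; _<ᵇ_; _⊓_)
open import Data.Nat.Divisibility using (_∣_; divides)
open import Data.Nat.Properties
open import Data.Nat.Tactic.RingSolver using (solve-∀)
open import Data.Product using (_,_; ∃; proj₁; proj₂; swap)
open import Data.Product.Properties using (≡-dec)
open import Data.Sum using (_⊎_; inj₁; inj₂; [_,_]′)
open import Function using (_∘_; case_of_; Equivalence)
open import Function.Bundles using (mk⇔)
open import Relation.Binary.PropositionalEquality
  using (refl; sym; trans; cong; cong₂; subst; _≢_; module ≡-Reasoning)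
open import Relation.Binary.Definitions using (tri<; tri≈; tri>)
open import Relation.Nullary using (Dec; yes; no; does)
open import Relation.Nullary.Decidable using (does-⇔; dec-false)

open Algebra.Properties.Semiring.Sum +-*-semiring
  using (sum; ∑-distrib-+; ∑-comm; *-distribˡ-sum; sum-replicate-zero)

entry-≤1 : ∀ b → entry b ≤ 1
entry-≤1 true  = s≤s z≤n
entry-≤1 false = z≤n

entry-injective : ∀ {x y} → entry x ≡ entry y → x ≡ y
entry-injective {true}  {true}  _ = refl
entry-injective {false} {false} _ = refl

entry-∧ : ∀ x y → entry (x ∧ y) ≡ entry x * entry y
entry-∧ true  y = sym (+-identityʳ (entry y))
entry-∧ false y = refl

entry-∨ : ∀ x y → (x ≡ true → y ≡ false) → entry (x ∨ y) ≡ entry x + entry y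
entry-∨ true  true  excl = case excl refl of λ ()
entry-∨ true  false excl = refl
entry-∨ false y     excl = refl

entry-*-≤ : ∀ b x → entry b * x ≤ x
entry-*-≤ true  x = ≤-reflexive (+-identityʳ x)
entry-*-≤ false x = z≤n

entry-≤⇒≡* : ∀ x y → entry x ≤ entry y → entry x ≡ entry x * entry y
entry-≤⇒≡* false y     _  = refl
entry-≤⇒≡* true  true  _  = refl
entry-≤⇒≡* true  false ()

≡ᵇ-sym : ∀ x y → (x ≡ᵇ y) ≡ (y ≡ᵇ x)
≡ᵇ-sym zero    zero    = refl
≡ᵇ-sym zero    (suc y) = refl
≡ᵇ-sym (suc x) zero    = refl
≡ᵇ-sym (suc x) (suc y) = ≡ᵇ-sym x y

≡ᵇ-refl : ∀ x → (x ≡ᵇ x) ≡ true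
≡ᵇ-refl x = Equivalence.to T-≡ (≡⇒≡ᵇ x x refl)

≡ᵇ-true⇒≡ : ∀ {x y} → (x ≡ᵇ y) ≡ true → x ≡ y
≡ᵇ-true⇒≡ {x} {y} eq = ≡ᵇ⇒≡ x y (Equivalence.from T-≡ eq)

≢⇒≡ᵇ≡false : ∀ {x y} → x ≢ y → (x ≡ᵇ y) ≡ false
≢⇒≡ᵇ≡false {x} {y} x≢y with x ≡ᵇ y in eq
... | false = refl
... | true  = ⊥-elim (x≢y (≡ᵇ-true⇒≡ eq))

<⇒<ᵇ≡true : ∀ {x y} → x < y → (x <ᵇ y) ≡ true
<⇒<ᵇ≡true x<y = Equivalence.to T-≡ (<⇒<ᵇ x<y)

≮⇒<ᵇ≡false : ∀ {x y} → ¬ x < y → (x <ᵇ y) ≡ false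
≮⇒<ᵇ≡false {x} {y} x≮y with x <ᵇ y in eq
... | false = refl
... | true  = ⊥-elim (x≮y (<ᵇ⇒< x y (Equivalence.from T-≡ eq)))

even≢odd′ : ∀ t x → t + t ≢ suc (x + x)
even≢odd′ t x t+t≡1+x+x = even≢odd t x (begin
  2 * t            ≡⟨ cong (t +_) (+-identityʳ t) ⟩
  t + t            ≡⟨ t+t≡1+x+x ⟩
  suc (x + x)      ≡⟨ cong (λ y → suc (x + y)) (+-identityʳ x) ⟨
  suc (2 * x)      ∎)
  where open ≡-Reasoning

parity : ∀ k → ∃ λ q → k ≡ q + q ⊎ k ≡ suc (q + q)
parity zero = 0 , inj₁ refl
parity (suc k) with parity k
... | q , inj₁ k≡2q   = q , inj₂ (cong suc k≡2q)
... | q , inj₂ k≡2q+1 = suc q , inj₁ (trans (cong suc k≡2q+1) (cong suc (sym (+-suc q q))))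

not-4∣-2*odd : ∀ s x → s * 4 ≢ 2 * suc (2 * x)
not-4∣-2*odd s x 4s≡2*odd = even≢odd s x (*-cancelˡ-≡ (2 * s) (suc (2 * x)) 2 (trans (four s) 4s≡2*odd))
  where
    four : ∀ s → 2 * (2 * s) ≡ s * 4
    four = solve-∀

-- With n = 1 + n' and m = 1 + m' the two hypotheses say that n m is even and
-- n' + m' is even, i.e. that n' and m' are both odd.
grid-parity : ∀ {n m} → 1 ≤ n → 1 ≤ m → Even (n * m) →
  4 ∣ m * ((n ∸ 1) + (n ∸ 1)) + n * ((m ∸ 1) + (m ∸ 1)) → Even n × Even m
grid-parity {suc n'} {suc m'} _ _ (t , nm≡t+t) (divides s total≡s*4) with parity n' | parity m'
... | q , inj₁ refl | r , inj₁ refl =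
  ⊥-elim (even≢odd′ t (q + r + 2 * q * r) (trans (sym nm≡t+t) (odd*odd q r)))
  where
    odd*odd : ∀ q r → suc (q + q) * suc (r + r) ≡ suc ((q + r + 2 * q * r) + (q + r + 2 * q * r))
    odd*odd = solve-∀
... | q , inj₁ refl | r , inj₂ refl =
  ⊥-elim (not-4∣-2*odd s (4 * q * r + 3 * q + r) (trans (sym total≡s*4) (total-eo q r)))
  where
    total-eo : ∀ q r → suc (suc (r + r)) * ((q + q) + (q + q)) + suc (q + q) * (suc (r + r) + suc (r + r))
                       ≡ 2 * suc (2 * (4 * q * r + 3 * q + r))
    total-eo = solve-∀
... | q , inj₂ refl | r , inj₁ refl =
  ⊥-elim (not-4∣-2*odd s (4 * q * r + 3 * r + q) (trans (sym total≡s*4) (total-oe q r)))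
  where
    total-oe : ∀ q r → suc (r + r) * (suc (q + q) + suc (q + q)) + suc (suc (q + q)) * ((r + r) + (r + r))
                       ≡ 2 * suc (2 * (4 * q * r + 3 * r + q))
    total-oe = solve-∀
... | q , inj₂ refl | r , inj₂ refl = (suc q , cong suc (sym (+-suc q q))) , (suc r , cong suc (sym (+-suc r r)))

*≤4⇒≤2 : ∀ {h k} → 2 ≤ k → h * k ≤ 4 → h ≤ 2
*≤4⇒≤2 {h} {k} 2≤k hk≤4 = *-cancelʳ-≤ h 2 2 (≤-trans (*-monoʳ-≤ h 2≤k) hk≤4)

≤2∧≤2∧3≤*⇒≡2 : ∀ {h k} → h ≤ 2 → k ≤ 2 → 3 ≤ h * k → h ≡ 2 × k ≡ 2
≤2∧≤2∧3≤*⇒≡2 {2} {2} _ _ _ = refl , refl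
≤2∧≤2∧3≤*⇒≡2 {0} {k} _ _ ()
≤2∧≤2∧3≤*⇒≡2 {1} {0} _ _ ()
≤2∧≤2∧3≤*⇒≡2 {1} {1} _ _ (s≤s ())
≤2∧≤2∧3≤*⇒≡2 {1} {2} _ _ (s≤s (s≤s ()))
≤2∧≤2∧3≤*⇒≡2 {2} {0} _ _ ()
≤2∧≤2∧3≤*⇒≡2 {2} {1} _ _ (s≤s (s≤s ()))
≤2∧≤2∧3≤*⇒≡2 {_} {suc (suc (suc _))} _ (s≤s (s≤s ())) _
≤2∧≤2∧3≤*⇒≡2 {suc (suc (suc _))} {_} (s≤s (s≤s ())) _ _

≢1⇒≥2 : ∀ {h} → 1 ≤ h → h ≢ 1 → 2 ≤ h
≢1⇒≥2 {suc zero}    _ h≢1 = ⊥-elim (h≢1 refl)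
≢1⇒≥2 {suc (suc h)} _ _   = s≤s (s≤s z≤n)

0<*⇒0<ˡ : ∀ h k → 0 < h * k → 0 < h
0<*⇒0<ˡ (suc h) k _ = s≤s z≤n

0<*⇒0<ʳ : ∀ h k → 0 < h * k → 0 < k
0<*⇒0<ʳ h k = 0<*⇒0<ˡ k h ∘ subst (0 <_) (*-comm h k)

≢1∧≢1∧*≤4⇒≡2 : ∀ {h k} → 0 < h * k → h ≢ 1 → k ≢ 1 → h * k ≤ 4 → h ≡ 2 × k ≡ 2
≢1∧≢1∧*≤4⇒≡2 {h} {k} 0<hk h≢1 k≢1 hk≤4 =
  ≤-antisym (*≤4⇒≤2 2≤k hk≤4) 2≤h , ≤-antisym (*≤4⇒≤2 2≤h (subst (_≤ 4) (*-comm h k) hk≤4)) 2≤k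
  where
    2≤h : 2 ≤ h
    2≤h = ≢1⇒≥2 (0<*⇒0<ˡ h k 0<hk) h≢1
    2≤k : 2 ≤ k
    2≤k = ≢1⇒≥2 (0<*⇒0<ʳ h k 0<hk) k≢1

*≡2⇒factor≡1 : ∀ h k → h * k ≡ 2 → h ≡ 1 ⊎ k ≡ 1
*≡2⇒factor≡1 h k hk≡2 with h ≟ 1 | k ≟ 1
... | yes h≡1 | _       = inj₁ h≡1
... | no  _   | yes k≡1 = inj₂ k≡1
... | no  h≢1 | no  k≢1
  with ≢1∧≢1∧*≤4⇒≡2 (subst (0 <_) (sym hk≡2) (s≤s z≤n)) h≢1 k≢1 (≤-trans (≤-reflexive hk≡2) (m≤m+n 2 2))
...   | refl , refl = case hk≡2 of λ ()

+≡4⇒≡2ʳ : ∀ {a b} → a ≤ 2 → b ≤ 2 → a + b ≡ 4 → b ≡ 2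
+≡4⇒≡2ʳ {a} {b} a≤2 b≤2 a+b≡4 = ≤-antisym b≤2 (+-cancelˡ-≤ 2 2 b (begin
  4      ≡⟨ a+b≡4 ⟨
  a + b  ≤⟨ +-monoˡ-≤ b a≤2 ⟩
  2 + b  ∎))
  where open ≤-Reasoning

-- Finite sums

∑≡sum : ∀ n (f : Fin n → ℕ) → ∑ n f ≡ sum f
∑≡sum zero    f = refl
∑≡sum (suc n) f = cong (f zero +_) (∑≡sum n (λ i → f (suc i)))

∑-cong : ∀ n {f g : Fin n → ℕ} → (∀ i → f i ≡ g i) → ∑ n f ≡ ∑ n g
∑-cong zero    f≗g = refl
∑-cong (suc n) f≗g = cong₂ _+_ (f≗g zero) (∑-cong n (λ i → f≗g (suc i)))

∑-zero : ∀ n → ∑ n (λ _ → 0) ≡ 0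
∑-zero n = trans (∑≡sum n _) (sum-replicate-zero n)

∑-const : ∀ n c → ∑ n (λ _ → c) ≡ n * c
∑-const zero    c = refl
∑-const (suc n) c = cong (c +_) (∑-const n c)

∑-+ : ∀ n (f g : Fin n → ℕ) → ∑ n (λ i → f i + g i) ≡ ∑ n f + ∑ n g
∑-+ n f g = begin
  ∑ n (λ i → f i + g i)  ≡⟨ ∑≡sum n _ ⟩
  sum (λ i → f i + g i)  ≡⟨ ∑-distrib-+ f g ⟩
  sum f + sum g          ≡⟨ cong₂ _+_ (∑≡sum n f) (∑≡sum n g) ⟨
  ∑ n f + ∑ n g          ∎
  where open ≡-Reasoning

∑-*ˡ : ∀ n c (f : Fin n → ℕ) → c * ∑ n f ≡ ∑ n (λ i → c * f i)
∑-*ˡ n c f = begin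
  c * ∑ n f              ≡⟨ cong (c *_) (∑≡sum n f) ⟩
  c * sum f              ≡⟨ *-distribˡ-sum c f ⟩
  sum (λ i → c * f i)    ≡⟨ ∑≡sum n _ ⟨
  ∑ n (λ i → c * f i)    ∎
  where open ≡-Reasoning

∑-*ʳ : ∀ n c (f : Fin n → ℕ) → ∑ n f * c ≡ ∑ n (λ i → f i * c)
∑-*ʳ n c f = trans (*-comm (∑ n f) c) (trans (∑-*ˡ n c f) (∑-cong n (λ i → *-comm c (f i))))

∑-swap : ∀ n m (f : Fin n → Fin m → ℕ) →
  ∑ n (λ i → ∑ m (λ j → f i j)) ≡ ∑ m (λ j → ∑ n (λ i → f i j))
∑-swap n m f = begin
  ∑ n (λ i → ∑ m (f i))                ≡⟨ ∑-cong n (λ i → ∑≡sum m (f i)) ⟩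
  ∑ n (λ i → sum (f i))                ≡⟨ ∑≡sum n _ ⟩
  sum (λ i → sum (f i))                ≡⟨ ∑-comm f ⟩
  sum (λ j → sum (λ i → f i j))        ≡⟨ ∑≡sum m _ ⟨
  ∑ m (λ j → sum (λ i → f i j))        ≡⟨ ∑-cong m (λ j → ∑≡sum n (λ i → f i j)) ⟨
  ∑ m (λ j → ∑ n (λ i → f i j))        ∎
  where open ≡-Reasoning

∑-mono : ∀ n {f g : Fin n → ℕ} → (∀ i → f i ≤ g i) → ∑ n f ≤ ∑ n g
∑-mono zero    f≤g = z≤n
∑-mono (suc n) f≤g = +-mono-≤ (f≤g zero) (∑-mono n (λ i → f≤g (suc i)))

∑-term-≤ : ∀ n (f : Fin n → ℕ) i → f i ≤ ∑ n f
∑-term-≤ (suc n) f zero    = m≤m+n (f zero) _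
∑-term-≤ (suc n) f (suc i) = m≤n⇒m≤o+n (f zero) (∑-term-≤ n (λ i → f (suc i)) i)

∑-two-terms-≤ : ∀ n (f : Fin n → ℕ) {i j} → i ≢ j → f i + f j ≤ ∑ n f
∑-two-terms-≤ (suc n) f {zero}  {zero}  i≢j = ⊥-elim (i≢j refl)
∑-two-terms-≤ (suc n) f {zero}  {suc j} i≢j = +-monoʳ-≤ (f zero) (∑-term-≤ n (λ i → f (suc i)) j)
∑-two-terms-≤ (suc n) f {suc i} {zero}  i≢j =
  subst (_≤ ∑ (suc n) f) (+-comm (f zero) (f (suc i))) (+-monoʳ-≤ (f zero) (∑-term-≤ n (λ i → f (suc i)) i))
∑-two-terms-≤ (suc n) f {suc i} {suc j} i≢j =
  m≤n⇒m≤o+n (f zero) (∑-two-terms-≤ n (λ i → f (suc i)) (i≢j ∘ cong suc))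

∑-positive : ∀ n (f : Fin n → ℕ) → 0 < ∑ n f → ∃ λ i → 0 < f i
∑-positive (suc n) f 0<∑ with f zero in eq
... | suc _ = zero , subst (0 <_) (sym eq) (s≤s z≤n)
... | zero  = let i , 0<fi = ∑-positive n (λ i → f (suc i)) 0<∑ in suc i , 0<fi

∑-select : ∀ n (z : Fin n) (f : Fin n → ℕ) → ∑ n (λ i → entry (does (z Fin.≟ i)) * f i) ≡ f z
∑-select (suc n) zero    f = trans (cong₂ _+_ (+-identityʳ (f zero)) (∑-zero n)) (+-identityʳ (f zero))
∑-select (suc n) (suc z) f = ∑-select n z (λ i → f (suc i))

module VertexSums (n m : ℕ) where

  ∑V-cong : {f g : Vtx n m → ℕ} → (∀ u → f u ≡ g u) → ∑V n m f ≡ ∑V n m g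
  ∑V-cong f≗g = ∑-cong n (λ i → ∑-cong m (λ j → f≗g (i , j)))

  ∑V-+ : (f g : Vtx n m → ℕ) → ∑V n m (λ u → f u + g u) ≡ ∑V n m f + ∑V n m g
  ∑V-+ f g = trans (∑-cong n (λ i → ∑-+ m _ _)) (∑-+ n _ _)

  ∑V-*ˡ : ∀ c (f : Vtx n m → ℕ) → c * ∑V n m f ≡ ∑V n m (λ u → c * f u)
  ∑V-*ˡ c f = trans (∑-*ˡ n c _) (∑-cong n (λ i → ∑-*ˡ m c _))

  ∑V-*ʳ : ∀ c (f : Vtx n m → ℕ) → ∑V n m f * c ≡ ∑V n m (λ u → f u * c)
  ∑V-*ʳ c f = trans (∑-*ʳ n c _) (∑-cong n (λ i → ∑-*ʳ m c _))

  ∑V-const : ∀ c → ∑V n m (λ _ → c) ≡ n * m * c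
  ∑V-const c = trans (∑-cong n (λ i → ∑-const m c)) (trans (∑-const n (m * c)) (sym (*-assoc n m c)))

  ∑V-swap : (f : Vtx n m → Vtx n m → ℕ) →
    ∑V n m (λ u → ∑V n m (λ v → f u v)) ≡ ∑V n m (λ v → ∑V n m (λ u → f u v))
  ∑V-swap f = begin
    ∑ n (λ i → ∑ m (λ j → ∑ n (λ i' → ∑ m (λ j' → f (i , j) (i' , j')))))
      ≡⟨ ∑-cong n (λ i → ∑-swap m n _) ⟩
    ∑ n (λ i → ∑ n (λ i' → ∑ m (λ j → ∑ m (λ j' → f (i , j) (i' , j')))))
      ≡⟨ ∑-cong n (λ i → ∑-cong n (λ i' → ∑-swap m m _)) ⟩
    ∑ n (λ i → ∑ n (λ i' → ∑ m (λ j' → ∑ m (λ j → f (i , j) (i' , j')))))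
      ≡⟨ ∑-swap n n _ ⟩
    ∑ n (λ i' → ∑ n (λ i → ∑ m (λ j' → ∑ m (λ j → f (i , j) (i' , j')))))
      ≡⟨ ∑-cong n (λ i' → ∑-swap n m _) ⟩
    ∑ n (λ i' → ∑ m (λ j' → ∑ n (λ i → ∑ m (λ j → f (i , j) (i' , j'))))) ∎
    where open ≡-Reasoning

  ∑V-mono : {f g : Vtx n m → ℕ} → (∀ u → f u ≤ g u) → ∑V n m f ≤ ∑V n m g
  ∑V-mono f≤g = ∑-mono n (λ i → ∑-mono m (λ j → f≤g (i , j)))

  ∑V-term-≤ : (f : Vtx n m → ℕ) → ∀ u → f u ≤ ∑V n m f
  ∑V-term-≤ f (i , j) =
    ≤-trans (∑-term-≤ m (λ j → f (i , j)) j) (∑-term-≤ n (λ i → ∑ m (λ j → f (i , j))) i)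

  ∑V-two-terms-≤ : (f : Vtx n m → ℕ) → ∀ {u v} → u ≢ v → f u + f v ≤ ∑V n m f
  ∑V-two-terms-≤ f {i , j} {i' , j'} u≢v with i Fin.≟ i'
  ... | yes refl = ≤-trans (∑-two-terms-≤ m (λ j → f (i , j)) (u≢v ∘ cong (i ,_)))
                           (∑-term-≤ n (λ i → ∑ m (λ j → f (i , j))) i)
  ... | no i≢i'  = ≤-trans (+-mono-≤ (∑-term-≤ m (λ j → f (i , j)) j) (∑-term-≤ m (λ j → f (i' , j)) j'))
                           (∑-two-terms-≤ n (λ i → ∑ m (λ j → f (i , j))) i≢i')

  ∑V-positive : (f : Vtx n m → ℕ) → 0 < ∑V n m f → ∃ λ u → 0 < f u
  ∑V-positive f 0<∑ =
    let i , 0<∑ᵢ = ∑-positive n _ 0<∑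
        j , 0<fij = ∑-positive m _ 0<∑ᵢ
    in (i , j) , 0<fij

  _≟V_ : (u v : Vtx n m) → Dec (u ≡ v)
  _≟V_ = ≡-dec Fin._≟_ Fin._≟_

  does-≟V : ∀ i j i' j' → does ((i , j) ≟V (i' , j')) ≡ does (i Fin.≟ i') ∧ does (j Fin.≟ j')
  does-≟V i j i' j' with i Fin.≟ i'
  ... | yes refl = refl
  ... | no _     = refl

  ∑V-select : ∀ z (f : Vtx n m → ℕ) → ∑V n m (λ w → entry (does (z ≟V w)) * f w) ≡ f z
  ∑V-select (i , j) f = begin
    ∑ n (λ i' → ∑ m (λ j' → entry (does ((i , j) ≟V (i' , j'))) * f (i' , j')))
      ≡⟨ ∑-cong n (λ i' → ∑-cong m (λ j' → split i' j')) ⟩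
    ∑ n (λ i' → ∑ m (λ j' → entry (does (i Fin.≟ i')) * (entry (does (j Fin.≟ j')) * f (i' , j'))))
      ≡⟨ ∑-cong n (λ i' → ∑-*ˡ m (entry (does (i Fin.≟ i'))) _) ⟨
    ∑ n (λ i' → entry (does (i Fin.≟ i')) * ∑ m (λ j' → entry (does (j Fin.≟ j')) * f (i' , j')))
      ≡⟨ ∑-cong n (λ i' → cong (entry (does (i Fin.≟ i')) *_) (∑-select m j (λ j' → f (i' , j')))) ⟩
    ∑ n (λ i' → entry (does (i Fin.≟ i')) * f (i' , j))
      ≡⟨ ∑-select n i (λ i' → f (i' , j)) ⟩
    f (i , j) ∎
    where
      open ≡-Reasoning
      split : ∀ i' j' → entry (does ((i , j) ≟V (i' , j'))) * f (i' , j')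
                      ≡ entry (does (i Fin.≟ i')) * (entry (does (j Fin.≟ j')) * f (i' , j'))
      split i' j' = begin
        entry (does ((i , j) ≟V (i' , j'))) * f (i' , j')
          ≡⟨ cong (λ b → entry b * f (i' , j')) (does-≟V i j i' j') ⟩
        entry (does (i Fin.≟ i') ∧ does (j Fin.≟ j')) * f (i' , j')
          ≡⟨ cong (_* f (i' , j')) (entry-∧ (does (i Fin.≟ i')) _) ⟩
        entry (does (i Fin.≟ i')) * entry (does (j Fin.≟ j')) * f (i' , j')
          ≡⟨ *-assoc (entry (does (i Fin.≟ i'))) _ _ ⟩
        entry (does (i Fin.≟ i')) * (entry (does (j Fin.≟ j')) * f (i' , j')) ∎

  ≟V-involution : (σ : Vtx n m → Vtx n m) → (∀ u → σ (σ u) ≡ u) →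
    ∀ u w → does (σ u ≟V w) ≡ does (σ w ≟V u)
  ≟V-involution σ σσ u w =
    does-⇔ (mk⇔ (λ σu≡w → trans (cong σ (sym σu≡w)) (σσ u))
                (λ σw≡u → trans (cong σ (sym σw≡u)) (σσ w)))
           (σ u ≟V w) (σ w ≟V u)

  ∑V-involution : (σ : Vtx n m → Vtx n m) → (∀ u → σ (σ u) ≡ u) →
    (f : Vtx n m → ℕ) → ∑V n m (λ u → f (σ u)) ≡ ∑V n m f
  ∑V-involution σ σσ f = begin
    ∑V n m (λ u → f (σ u))                                        ≡⟨ ∑V-cong (λ u → ∑V-select (σ u) f) ⟨
    ∑V n m (λ u → ∑V n m (λ w → entry (does (σ u ≟V w)) * f w))  ≡⟨ ∑V-swap _ ⟩
    ∑V n m (λ w → ∑V n m (λ u → entry (does (σ u ≟V w)) * f w))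
      ≡⟨ ∑V-cong (λ w → ∑V-cong (λ u → cong (λ b → entry b * f w) (≟V-involution σ σσ u w))) ⟩
    ∑V n m (λ w → ∑V n m (λ u → entry (does (σ w ≟V u)) * f w))
      ≡⟨ ∑V-cong (λ w → ∑V-select (σ w) (λ _ → f w)) ⟩
    ∑V n m f                                                      ∎
    where open ≡-Reasoning

  rank : Vtx n m → ℕ
  rank (i , j) = toℕ (combine i j)

  rank-injective : ∀ u v → rank u ≡ rank v → u ≡ v
  rank-injective (i , j) (i' , j') eq with Fin.combine-injective i j i' j' (Fin.toℕ-injective eq)
  ... | refl , refl = refl

  precedes : Vtx n m → Vtx n m → ℕ
  precedes u v = entry (rank u <ᵇ rank v)

  precedes-total : ∀ {u v} → u ≢ v → precedes u v + precedes v u ≡ 1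
  precedes-total {u} {v} u≢v with <-cmp (rank u) (rank v)
  ... | tri< u<v _ v≮u = cong₂ _+_ (cong entry (<⇒<ᵇ≡true u<v)) (cong entry (≮⇒<ᵇ≡false v≮u))
  ... | tri≈ _ u=v _   = ⊥-elim (u≢v (rank-injective u v u=v))
  ... | tri> u≮v _ v<u = cong₂ _+_ (cong entry (≮⇒<ᵇ≡false u≮v)) (cong entry (<⇒<ᵇ≡true v<u))

  -- Split the off-diagonal entries by which index comes first; transposition swaps the two halves.
  ∑V²-symmetric-even : (f : Vtx n m → Vtx n m → ℕ) → (∀ u v → f u v ≡ f v u) → (∀ u → f u u ≡ 0) →
    Even (∑V n m (λ u → ∑V n m (f u)))
  ∑V²-symmetric-even f f-sym f-diag = t , (begin
    ∑V n m (λ u → ∑V n m (λ v → f u v))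
      ≡⟨ ∑V-cong (λ u → ∑V-cong (λ v → split u v)) ⟩
    ∑V n m (λ u → ∑V n m (λ v → f u v * precedes u v + f u v * precedes v u))
      ≡⟨ trans (∑V-cong (λ u → ∑V-+ _ _)) (∑V-+ _ _) ⟩
    t + ∑V n m (λ u → ∑V n m (λ v → f u v * precedes v u))
      ≡⟨ cong (t +_) (∑V-swap _) ⟩
    t + ∑V n m (λ v → ∑V n m (λ u → f u v * precedes v u))
      ≡⟨ cong (t +_) (∑V-cong (λ v → ∑V-cong (λ u → cong (_* precedes v u) (f-sym u v)))) ⟩
    t + t ∎)
    where
      open ≡-Reasoning
      t : ℕ
      t = ∑V n m (λ u → ∑V n m (λ v → f u v * precedes u v))
      split : ∀ u v → f u v ≡ f u v * precedes u v + f u v * precedes v u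
      split u v with u ≟V v
      ... | yes refl = trans (f-diag u) (cong (λ x → x * precedes u u + x * precedes u u) (sym (f-diag u)))
      ... | no u≢v   = sym (trans (sym (*-distribˡ-+ (f u v) _ _))
                                  (trans (cong (f u v *_) (precedes-total u≢v)) (*-identityʳ (f u v))))

-- Products of adjacency matrices

module _ {n m : ℕ} where
  open VertexSums n m

  A : SimpleGraph (Vtx n m) → Vtx n m → Vtx n m → ℕ
  A G u v = entry (adj G u v)

  deg : SimpleGraph (Vtx n m) → Vtx n m → ℕ
  deg G u = ∑V n m (A G u)

  A-sym : (G : SimpleGraph (Vtx n m)) → ∀ u v → A G u v ≡ A G v u
  A-sym G u v = cong entry (SimpleGraph.sym G u v)

  record IsProduct (G H K : SimpleGraph (Vtx n m)) : Set where
    constructor product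
    field entries : ∀ u v → A G u v ≡ ∑V n m (λ w → A H u w * A K w v)

  module _ {G H K : SimpleGraph (Vtx n m)} (G=HK : IsProduct G H K) where
    open IsProduct G=HK

    IsProduct-swap : IsProduct G K H
    IsProduct-swap = product λ u v → begin
      A G u v                              ≡⟨ A-sym G u v ⟩
      A G v u                              ≡⟨ entries v u ⟩
      ∑V n m (λ w → A H v w * A K w u)
        ≡⟨ ∑V-cong (λ w → trans (*-comm (A H v w) _) (cong₂ _*_ (A-sym K w u) (A-sym H v w))) ⟩
      ∑V n m (λ w → A K u w * A H w v)     ∎
      where open ≡-Reasoning

    A-≤-product : ∀ {u w} v → adj H u w ≡ true → A K w v ≤ A G u v
    A-≤-product {u} {w} v uw = begin
      A K w v                    ≡⟨ +-identityʳ (A K w v) ⟨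
      1 * A K w v                ≡⟨ cong (λ b → entry b * A K w v) uw ⟨
      A H u w * A K w v          ≤⟨ ∑V-term-≤ (λ w → A H u w * A K w v) w ⟩
      ∑V n m (λ w → A H u w * A K w v)  ≡⟨ entries u v ⟨
      A G u v                    ∎
      where open ≤-Reasoning

    -- If u w is an H-edge, every K-neighbour of w is a G-neighbour of u; summing G = K H
    -- over these neighbours bounds deg K w by deg K u.
    deg-≤-along : ∀ {u w} → adj H u w ≡ true → deg K w ≤ deg K u
    deg-≤-along {u} {w} uw = begin
      ∑V n m (λ x → A K w x)
        ≡⟨ ∑V-cong (λ x → entry-≤⇒≡* (adj K w x) _ (subst (A K w x ≤_) (A-sym G u x) (A-≤-product x uw))) ⟩
      ∑V n m (λ x → A K w x * A G x u)
        ≡⟨ ∑V-cong (λ x → trans (cong (A K w x *_) (entries x u)) (∑V-*ˡ (A K w x) _)) ⟩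
      ∑V n m (λ x → ∑V n m (λ y → A K w x * (A H x y * A K y u)))
        ≡⟨ ∑V-swap _ ⟩
      ∑V n m (λ y → ∑V n m (λ x → A K w x * (A H x y * A K y u)))
        ≡⟨ ∑V-cong (λ y → trans (∑V-cong (λ x → sym (*-assoc (A K w x) _ _))) (sym (∑V-*ʳ (A K y u) _))) ⟩
      ∑V n m (λ y → ∑V n m (λ x → A K w x * A H x y) * A K y u)
        ≡⟨ ∑V-cong (λ y → cong (_* A K y u) (IsProduct.entries IsProduct-swap w y)) ⟨
      ∑V n m (λ y → A G w y * A K y u)
        ≤⟨ ∑V-mono (λ y → entry-*-≤ (adj G w y) (A K y u)) ⟩
      ∑V n m (λ y → A K y u)
        ≡⟨ ∑V-cong (λ y → A-sym K y u) ⟩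
      ∑V n m (λ y → A K u y) ∎
      where open ≤-Reasoning

    deg-along : ∀ {u w} → adj H u w ≡ true → deg K w ≡ deg K u
    deg-along {u} {w} uw = ≤-antisym (deg-≤-along uw) (deg-≤-along (trans (SimpleGraph.sym H w u) uw))

    deg-product : ∀ u → deg G u ≡ deg H u * deg K u
    deg-product u = begin
      ∑V n m (λ v → A G u v)                              ≡⟨ ∑V-cong (entries u) ⟩
      ∑V n m (λ v → ∑V n m (λ w → A H u w * A K w v))     ≡⟨ ∑V-swap _ ⟩
      ∑V n m (λ w → ∑V n m (λ v → A H u w * A K w v))     ≡⟨ ∑V-cong (λ w → ∑V-*ˡ (A H u w) (A K w)) ⟨
      ∑V n m (λ w → A H u w * deg K w)                    ≡⟨ ∑V-cong along ⟩
      ∑V n m (λ w → A H u w * deg K u)                    ≡⟨ ∑V-*ʳ (deg K u) (A H u) ⟨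
      deg H u * deg K u                                   ∎
      where
        open ≡-Reasoning
        along : ∀ w → A H u w * deg K w ≡ A H u w * deg K u
        along w with adj H u w in uw
        ... | true  = cong (1 *_) (deg-along uw)
        ... | false = refl

    edge-witness : ∀ {v u} → adj G v u ≡ true → ∃ λ w → adj H v w ≡ true × adj K w u ≡ true
    edge-witness {v} {u} vu with ∑V-positive (λ w → A H v w * A K w u) 0<∑
      where
        0<∑ : 0 < ∑V n m (λ w → A H v w * A K w u)
        0<∑ = subst (0 <_) (trans (cong entry (sym vu)) (entries v u)) (s≤s z≤n)
    ... | w , 0<HK with adj H v w in vw | adj K w u in wu
    ...   | true  | true  = w , vw , wu
    ...   | true  | false = ⊥-elim (<-irrefl refl 0<HK)
    ...   | false | _     = ⊥-elim (<-irrefl refl 0<HK)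

  -- The degree constraints that a factorisation G = H K imposes, with h = deg H and k = deg K.
  record DegreeSplitting (G : SimpleGraph (Vtx n m)) (h k : Vtx n m → ℕ) : Set where
    field
      deg≡h*k  : ∀ u → deg G u ≡ h u * k u
      edge-deg : ∀ {v u} → adj G v u ≡ true → ∃ λ y → deg G y ≡ h u * k v

  DegreeSplitting-swap : ∀ {G h k} → DegreeSplitting G h k → DegreeSplitting G k h
  DegreeSplitting-swap {G} {h} {k} S = record
    { deg≡h*k  = λ u → trans (deg≡h*k u) (*-comm (h u) (k u))
    ; edge-deg = λ {v} {u} vu → let y , deg-y = edge-deg (trans (SimpleGraph.sym G u v) vu)
                                in y , trans deg-y (*-comm (h v) (k u))
    }
    where open DegreeSplitting S

  product⇒splitting : ∀ {G H K} → IsProduct G H K → DegreeSplitting G (deg H) (deg K)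
  product⇒splitting {G} {H} {K} G=HK = record
    { deg≡h*k  = deg-product G=HK
    ; edge-deg = λ {v} {u} vu →
        let w , vw , wu = edge-witness G=HK vu
        in w , trans (deg-product G=HK w)
                     (cong₂ _*_ (sym (deg-along (IsProduct-swap G=HK) wu)) (deg-along G=HK vw))
    }

-- Fixed-point-free involutions

module _ {n m : ℕ} where
  open VertexSums n m

  -- Such involutions correspond to the factorisations G = H K with H a perfect matching:
  -- H pairs u with σ u, and K = G ∘ σ.
  record FreeInvolution (G : SimpleGraph (Vtx n m)) : Set where
    field
      σ                  : Vtx n m → Vtx n m
      σ-involutive       : ∀ u → σ (σ u) ≡ u
      σ-fixed-point-free : ∀ u → σ u ≢ u
      σ-automorphism     : ∀ u v → adj G (σ u) (σ v) ≡ adj G u v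
      σ-nonadjacent      : ∀ u → adj G u (σ u) ≡ false

  module FreeInvolutionProperties {G : SimpleGraph (Vtx n m)} (ι : FreeInvolution G) where
    open FreeInvolution ι

    marked : Vtx n m → ℕ
    marked u = precedes u (σ u)

    marked-orbit : ∀ u → marked u + marked (σ u) ≡ 1
    marked-orbit u = trans (cong (λ w → precedes u (σ u) + precedes (σ u) w) (σ-involutive u))
                           (precedes-total (σ-fixed-point-free u ∘ sym))

    ∑V-orbits : (f : Vtx n m → ℕ) →
      ∑V n m f ≡ ∑V n m (λ u → marked u * f u) + ∑V n m (λ u → marked u * f (σ u))
    ∑V-orbits f = begin
      ∑V n m f
        ≡⟨ ∑V-cong (λ u → trans (sym (*-identityˡ (f u))) (cong (_* f u) (sym (marked-orbit u)))) ⟩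
      ∑V n m (λ u → (marked u + marked (σ u)) * f u)
        ≡⟨ trans (∑V-cong (λ u → *-distribʳ-+ (f u) (marked u) _)) (∑V-+ _ _) ⟩
      ∑V n m (λ u → marked u * f u) + ∑V n m (λ u → marked (σ u) * f u)
        ≡⟨ cong (∑V n m (λ u → marked u * f u) +_) (∑V-involution σ σ-involutive (λ u → marked (σ u) * f u)) ⟨
      ∑V n m (λ u → marked u * f u) + ∑V n m (λ u → marked (σ (σ u)) * f (σ u))
        ≡⟨ cong (∑V n m (λ u → marked u * f u) +_) (∑V-cong (λ u → cong (λ w → marked w * f (σ u)) (σ-involutive u))) ⟩
      ∑V n m (λ u → marked u * f u) + ∑V n m (λ u → marked u * f (σ u)) ∎
      where open ≡-Reasoning

    even-order : Even (n * m)
    even-order = ∑V n m marked , (begin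
      n * m                                                       ≡⟨ *-identityʳ (n * m) ⟨
      n * m * 1                                                   ≡⟨ ∑V-const 1 ⟨
      ∑V n m (λ _ → 1)                                            ≡⟨ ∑V-orbits (λ _ → 1) ⟩
      ∑V n m (λ u → marked u * 1) + ∑V n m (λ u → marked u * 1)  ≡⟨ cong (λ s → s + s) (∑V-cong (*-identityʳ ∘ marked)) ⟩
      ∑V n m marked + ∑V n m marked                               ∎)
      where open ≡-Reasoning

    deg-σ : ∀ u → deg G (σ u) ≡ deg G u
    deg-σ u = begin
      ∑V n m (λ v → A G (σ u) v)        ≡⟨ ∑V-involution σ σ-involutive (A G (σ u)) ⟨
      ∑V n m (λ v → A G (σ u) (σ v))    ≡⟨ ∑V-cong (λ v → cong entry (σ-automorphism u v)) ⟩
      ∑V n m (λ v → A G u v)            ∎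
      where open ≡-Reasoning

    ∑V² : (Vtx n m → Vtx n m → ℕ) → ℕ
    ∑V² f = ∑V n m (λ u → ∑V n m (f u))

    within across : Vtx n m → Vtx n m → ℕ
    within u v = marked u * marked v * A G u v
    across u v = marked u * marked v * A G u (σ v)

    within-even : Even (∑V² within)
    within-even = ∑V²-symmetric-even within symmetric diagonal
      where
        symmetric : ∀ u v → within u v ≡ within v u
        symmetric u v = cong₂ _*_ (*-comm (marked u) (marked v)) (A-sym G u v)
        diagonal : ∀ u → within u u ≡ 0
        diagonal u =
          trans (cong (λ b → marked u * marked u * entry b) (SimpleGraph.irrefl G u)) (*-zeroʳ (marked u * marked u))

    across-even : Even (∑V² across)
    across-even = ∑V²-symmetric-even across symmetric diagonal
      where
        A-across : ∀ u v → A G u (σ v) ≡ A G v (σ u)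
        A-across u v = begin
          A G u (σ v)               ≡⟨ cong entry (σ-automorphism u (σ v)) ⟨
          A G (σ u) (σ (σ v))       ≡⟨ cong (A G (σ u)) (σ-involutive v) ⟩
          A G (σ u) v               ≡⟨ A-sym G (σ u) v ⟩
          A G v (σ u)               ∎
          where open ≡-Reasoning
        symmetric : ∀ u v → across u v ≡ across v u
        symmetric u v = cong₂ _*_ (*-comm (marked u) (marked v)) (A-across u v)
        diagonal : ∀ u → across u u ≡ 0
        diagonal u =
          trans (cong (λ b → marked u * marked u * entry b) (σ-nonadjacent u)) (*-zeroʳ (marked u * marked u))

    ∑marked-deg : ∑V n m (λ u → marked u * deg G u) ≡ ∑V² within + ∑V² across
    ∑marked-deg = begin
      ∑V n m (λ u → marked u * deg G u)
        ≡⟨ ∑V-cong (λ u → cong (marked u *_) (∑V-orbits (A G u))) ⟩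
      ∑V n m (λ u → marked u * (∑V n m (λ v → marked v * A G u v) + ∑V n m (λ v → marked v * A G u (σ v))))
        ≡⟨ ∑V-cong (λ u → *-distribˡ-+ (marked u) _ _) ⟩
      ∑V n m (λ u → marked u * ∑V n m (λ v → marked v * A G u v) + marked u * ∑V n m (λ v → marked v * A G u (σ v)))
        ≡⟨ ∑V-cong (λ u → cong₂ _+_ (pull u (A G u)) (pull u (λ v → A G u (σ v)))) ⟩
      ∑V n m (λ u → ∑V n m (within u) + ∑V n m (across u))
        ≡⟨ ∑V-+ _ _ ⟩
      ∑V² within + ∑V² across ∎
      where
        open ≡-Reasoning
        pull : ∀ u (a : Vtx n m → ℕ) →
          marked u * ∑V n m (λ v → marked v * a v) ≡ ∑V n m (λ v → marked u * marked v * a v)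
        pull u a = trans (∑V-*ˡ (marked u) _) (∑V-cong (λ v → sym (*-assoc (marked u) (marked v) (a v))))

    -- Since deg is σ-invariant, ∑ deg = 2 ∑ marked · deg, and the latter sum splits into
    -- the totals of two symmetric matrices with zero diagonal.
    four-∣-∑deg : 4 ∣ ∑V n m (deg G)
    four-∣-∑deg = divides (p + q) (begin
      ∑V n m (deg G)
        ≡⟨ ∑V-orbits (deg G) ⟩
      T + ∑V n m (λ u → marked u * deg G (σ u))
        ≡⟨ cong (T +_) (∑V-cong (λ u → cong (marked u *_) (deg-σ u))) ⟩
      T + T
        ≡⟨ cong (λ t → t + t) ∑marked-deg ⟩
      (∑V² within + ∑V² across) + (∑V² within + ∑V² across)
        ≡⟨ cong (λ t → t + t) (cong₂ _+_ (proj₂ within-even) (proj₂ across-even)) ⟩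
      ((p + p) + (q + q)) + ((p + p) + (q + q))
        ≡⟨ arith p q ⟩
      (p + q) * 4 ∎)
      where
        open ≡-Reasoning
        T p q : ℕ
        T = ∑V n m (λ u → marked u * deg G u)
        p = proj₁ within-even
        q = proj₁ across-even
        arith : ∀ p q → ((p + p) + (q + q)) + ((p + p) + (q + q)) ≡ (p + q) * 4
        arith = solve-∀

  module PerfectMatching {H : SimpleGraph (Vtx n m)} (deg≡1 : ∀ u → deg H u ≡ 1) where

    private
      0<deg : ∀ u → 0 < ∑V n m (A H u)
      0<deg u = subst (0 <_) (sym (deg≡1 u)) (s≤s z≤n)

    mate : Vtx n m → Vtx n m
    mate u = proj₁ (∑V-positive (A H u) (0<deg u))

    adj-mate : ∀ u → adj H u (mate u) ≡ true
    adj-mate u with adj H u (mate u) | proj₂ (∑V-positive (A H u) (0<deg u))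
    ... | true  | _  = refl
    ... | false | ()

    mate-unique : ∀ {u w} → adj H u w ≡ true → w ≡ mate u
    mate-unique {u} {w} uw with w ≟V mate u
    ... | yes w≡mate = w≡mate
    ... | no  w≢mate = ⊥-elim (<-irrefl refl (begin-strict
      1                        <⟨ s≤s (s≤s z≤n) ⟩
      2                        ≡⟨ cong₂ (λ a b → entry a + entry b) uw (adj-mate u) ⟨
      A H u w + A H u (mate u) ≤⟨ ∑V-two-terms-≤ (A H u) w≢mate ⟩
      deg H u                  ≡⟨ deg≡1 u ⟩
      1                        ∎))
      where open ≤-Reasoning

    A≡mate-indicator : ∀ u w → A H u w ≡ entry (does (mate u ≟V w))
    A≡mate-indicator u w with mate u ≟V w
    ... | yes refl = cong entry (adj-mate u)
    ... | no mate≢w with adj H u w in uw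
    ...   | true  = ⊥-elim (mate≢w (sym (mate-unique uw)))
    ...   | false = refl

    mate-involutive : ∀ u → mate (mate u) ≡ u
    mate-involutive u = sym (mate-unique (trans (SimpleGraph.sym H (mate u) u) (adj-mate u)))

    mate-fixed-point-free : ∀ u → mate u ≢ u
    mate-fixed-point-free u mate≡u =
      case trans (sym (subst (λ w → adj H u w ≡ true) mate≡u (adj-mate u))) (SimpleGraph.irrefl H u) of λ ()

  matching-factor⇒free-involution : ∀ {G H K} → IsProduct G H K → (∀ u → deg H u ≡ 1) → FreeInvolution G
  matching-factor⇒free-involution {G} {H} {K} G=HK deg≡1 = record
    { σ                  = mate
    ; σ-involutive       = mate-involutive
    ; σ-fixed-point-free = mate-fixed-point-free
    ; σ-automorphism     = λ u v → begin
        adj G (mate u) (mate v)         ≡⟨ G≡K∘mate (mate u) (mate v) ⟩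
        adj K (mate (mate u)) (mate v)  ≡⟨ cong (λ w → adj K w (mate v)) (mate-involutive u) ⟩
        adj K u (mate v)                ≡⟨ SimpleGraph.sym K u (mate v) ⟩
        adj K (mate v) u                ≡⟨ G≡K∘mate v u ⟨
        adj G v u                       ≡⟨ SimpleGraph.sym G v u ⟩
        adj G u v                       ∎
    ; σ-nonadjacent      = λ u → trans (G≡K∘mate u (mate u)) (SimpleGraph.irrefl K (mate u))
    }
    where
      open PerfectMatching {H} deg≡1
      open ≡-Reasoning
      G≡K∘mate : ∀ u v → adj G u v ≡ adj K (mate u) v
      G≡K∘mate u v = entry-injective (begin
        A G u v
          ≡⟨ IsProduct.entries G=HK u v ⟩
        ∑V n m (λ w → A H u w * A K w v)
          ≡⟨ ∑V-cong (λ w → cong (_* A K w v) (A≡mate-indicator u w)) ⟩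
        ∑V n m (λ w → entry (does (mate u ≟V w)) * A K w v)
          ≡⟨ ∑V-select (mate u) (λ w → A K w v) ⟩
        A K (mate u) v ∎)

  free-involution⇒factorable : ∀ {G} → FreeInvolution G → Factorable n m (adj G)
  free-involution⇒factorable {G} ι = H , K , λ u v → sym (begin
    ∑V n m (λ w → entry (does (σ u ≟V w)) * A G (σ w) v)  ≡⟨ ∑V-select (σ u) (λ w → A G (σ w) v) ⟩
    A G (σ (σ u)) v                                       ≡⟨ cong (λ w → A G w v) (σ-involutive u) ⟩
    A G u v                                               ∎)
    where
      open FreeInvolution ι
      open ≡-Reasoning
      H : SimpleGraph (Vtx n m)
      H = record
        { adj    = λ u w → does (σ u ≟V w)
        ; sym    = ≟V-involution σ σ-involutive
        ; irrefl = λ u → dec-false (σ u ≟V u) (σ-fixed-point-free u)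
        }
      K : SimpleGraph (Vtx n m)
      K = record
        { adj    = λ w v → adj G (σ w) v
        ; sym    = λ w v → begin
            adj G (σ w) v            ≡⟨ cong (adj G (σ w)) (σ-involutive v) ⟨
            adj G (σ w) (σ (σ v))    ≡⟨ σ-automorphism w (σ v) ⟩
            adj G w (σ v)            ≡⟨ SimpleGraph.sym G w (σ v) ⟩
            adj G (σ v) w            ∎
        ; irrefl = λ v → trans (SimpleGraph.sym G (σ v) v) (σ-nonadjacent v)
        }

-- Paths and grids

module _ {k : ℕ} where

  pathAdj-sym : (a b : Fin k) → pathAdj a b ≡ pathAdj b a
  pathAdj-sym a b = ∨-comm (suc (toℕ a) ≡ᵇ toℕ b) _

  pathAdj-irrefl : (a : Fin k) → pathAdj a a ≡ false
  pathAdj-irrefl a rewrite ≢⇒≡ᵇ≡false (1+n≢n {toℕ a}) = refl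

  pathAdj-≡ᵇ : (a b : Fin k) → (toℕ a ≡ᵇ toℕ b) ≡ true → pathAdj a b ≡ false
  pathAdj-≡ᵇ a b a≡b =
    trans (cong (λ x → (suc x ≡ᵇ toℕ b) ∨ (suc (toℕ b) ≡ᵇ x)) (≡ᵇ-true⇒≡ a≡b)) (pathAdj-irrefl b)

  entry-pathAdj : (a b : Fin k) →
    entry (pathAdj a b) ≡ entry (suc (toℕ a) ≡ᵇ toℕ b) + entry (suc (toℕ b) ≡ᵇ toℕ a)
  entry-pathAdj a b =
    entry-∨ _ _ (λ a→b → ≢⇒≡ᵇ≡false (λ b→a → 2+n≢n (toℕ a) (trans (cong suc (≡ᵇ-true⇒≡ a→b)) b→a)))
    where
      2+n≢n : ∀ x → suc (suc x) ≢ x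
      2+n≢n zero    ()
      2+n≢n (suc x) eq = 2+n≢n x (suc-injective eq)

  pathAdj-inject₁-suc : (j : Fin k) → pathAdj (inject₁ j) (suc j) ≡ true
  pathAdj-inject₁-suc j rewrite Fin.toℕ-inject₁ j | ≡ᵇ-refl (toℕ j) = refl

∑-≡ᵇ-count : ∀ k c → ∑ k (λ x → entry (c ≡ᵇ toℕ x)) ≡ entry (c <ᵇ k)
∑-≡ᵇ-count zero    c       = refl
∑-≡ᵇ-count (suc k) zero    = cong suc (∑-zero k)
∑-≡ᵇ-count (suc k) (suc c) = ∑-≡ᵇ-count k c

∑-≡ᵇ-count-< : ∀ k c → c < k → ∑ k (λ x → entry (c ≡ᵇ toℕ x)) ≡ 1
∑-≡ᵇ-count-< k c c<k = trans (∑-≡ᵇ-count k c) (cong entry (<⇒<ᵇ≡true c<k))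

-- The degree of vertex t in P_k; only meaningful for t < k.
pathDeg : ℕ → ℕ → ℕ
pathDeg k t = entry (0 <ᵇ t) + entry (suc t <ᵇ k)

∑-pathAdj : ∀ k (a : Fin k) → ∑ k (λ x → entry (pathAdj a x)) ≡ pathDeg k (toℕ a)
∑-pathAdj k a = begin
  ∑ k (λ x → entry (pathAdj a x))
    ≡⟨ trans (∑-cong k (entry-pathAdj a)) (∑-+ k _ _) ⟩
  ∑ k (λ x → entry (suc (toℕ a) ≡ᵇ toℕ x)) + ∑ k (λ x → entry (suc (toℕ x) ≡ᵇ toℕ a))
    ≡⟨ cong₂ _+_ (∑-≡ᵇ-count k (suc (toℕ a))) (predecessors (toℕ a) (Fin.toℕ<n a)) ⟩
  entry (suc (toℕ a) <ᵇ k) + entry (0 <ᵇ toℕ a)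
    ≡⟨ +-comm (entry (suc (toℕ a) <ᵇ k)) _ ⟩
  pathDeg k (toℕ a) ∎
  where
    open ≡-Reasoning
    predecessors : ∀ t → t < k → ∑ k (λ x → entry (suc (toℕ x) ≡ᵇ t)) ≡ entry (0 <ᵇ t)
    predecessors zero    _   = ∑-zero k
    predecessors (suc t) t<k =
      trans (∑-cong k (λ x → cong entry (≡ᵇ-sym (toℕ x) t))) (∑-≡ᵇ-count-< k t (<-trans (n<1+n t) t<k))

pathDeg-≤2 : ∀ k t → pathDeg k t ≤ 2
pathDeg-≤2 k t = +-mono-≤ (entry-≤1 (0 <ᵇ t)) (entry-≤1 (suc t <ᵇ k))

pathDeg-≥1 : ∀ {k} t → 2 ≤ k → t < k → 1 ≤ pathDeg k t
pathDeg-≥1 {suc (suc k)} zero    _ _ = s≤s z≤n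
pathDeg-≥1 {suc zero}    zero    (s≤s ()) _
pathDeg-≥1               (suc t) _ _ = s≤s z≤n

pathDeg-interior : ∀ {k t} → 0 < t → suc t < k → pathDeg k t ≡ 2
pathDeg-interior 0<t 1+t<k rewrite <⇒<ᵇ≡true 0<t | <⇒<ᵇ≡true 1+t<k = refl

pathDeg≡2⇒interior : ∀ {k} t → pathDeg k t ≡ 2 → 0 < t × suc t < k
pathDeg≡2⇒interior {k} t deg≡2 with 0 <ᵇ t in 0<ᵇt | suc t <ᵇ k in 1+t<ᵇk
... | true  | true  = <ᵇ⇒< 0 t (Equivalence.from T-≡ 0<ᵇt) , <ᵇ⇒< (suc t) k (Equivalence.from T-≡ 1+t<ᵇk)
... | true  | false = case deg≡2 of λ ()
... | false | b     = ⊥-elim (<-irrefl deg≡2 (s≤s (entry-≤1 b)))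

pathDeg-first : ∀ {k} → 2 ≤ k → pathDeg k 0 ≡ 1
pathDeg-first {suc (suc k)} _ = refl
pathDeg-first {suc zero} (s≤s ())

module _ (n m : ℕ) where

  gridAdj-sym : ∀ u v → gridAdj n m u v ≡ gridAdj n m v u
  gridAdj-sym (i , j) (i' , j')
    rewrite ≡ᵇ-sym (toℕ i) (toℕ i') | ≡ᵇ-sym (toℕ j) (toℕ j') | pathAdj-sym i i' | pathAdj-sym j j' = refl

  gridAdj-irrefl : ∀ u → gridAdj n m u u ≡ false
  gridAdj-irrefl (i , j)
    rewrite pathAdj-irrefl i | pathAdj-irrefl j | ∧-zeroʳ (toℕ i ≡ᵇ toℕ i) | ∧-zeroʳ (toℕ j ≡ᵇ toℕ j) = refl

Grid : (n m : ℕ) → SimpleGraph (Vtx n m)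
Grid n m = record { adj = gridAdj n m ; sym = gridAdj-sym n m ; irrefl = gridAdj-irrefl n m }

gridAdj-right : ∀ {n m} (i : Fin n) (j : Fin m) → gridAdj n (suc m) (i , inject₁ j) (i , suc j) ≡ true
gridAdj-right i j rewrite ≡ᵇ-refl (toℕ i) =
  cong (_∨ ((toℕ (inject₁ j) ≡ᵇ suc (toℕ j)) ∧ pathAdj i i)) (pathAdj-inject₁-suc j)

gridAdj-down : ∀ {n m} (i : Fin n) (j : Fin m) → gridAdj (suc n) m (inject₁ i , j) (suc i , j) ≡ true
gridAdj-down i j rewrite ≡ᵇ-refl (toℕ j) =
  trans (cong (((toℕ (inject₁ i) ≡ᵇ suc (toℕ i)) ∧ pathAdj j j) ∨_) (pathAdj-inject₁-suc i)) (∨-zeroʳ _)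

module _ {n m : ℕ} where
  open VertexSums n m

  entry-gridAdj : ∀ i j i' j' → entry (gridAdj n m (i , j) (i' , j')) ≡
    entry (toℕ i ≡ᵇ toℕ i') * entry (pathAdj j j') + entry (toℕ j ≡ᵇ toℕ j') * entry (pathAdj i i')
  entry-gridAdj i j i' j' =
    trans (entry-∨ _ _ same-row⇒not-column) (cong₂ _+_ (entry-∧ (toℕ i ≡ᵇ toℕ i') _) (entry-∧ (toℕ j ≡ᵇ toℕ j') _))
    where
      same-row⇒not-column : (toℕ i ≡ᵇ toℕ i') ∧ pathAdj j j' ≡ true → (toℕ j ≡ᵇ toℕ j') ∧ pathAdj i i' ≡ false
      same-row⇒not-column row =
        trans (cong ((toℕ j ≡ᵇ toℕ j') ∧_) (pathAdj-≡ᵇ i i' (∧-conicalˡ _ _ row))) (∧-zeroʳ _)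

  deg-Grid : ∀ i j → deg (Grid n m) (i , j) ≡ pathDeg n (toℕ i) + pathDeg m (toℕ j)
  deg-Grid i j = begin
    ∑ n (λ i' → ∑ m (λ j' → entry (gridAdj n m (i , j) (i' , j'))))
      ≡⟨ ∑-cong n row-sum ⟩
    ∑ n (λ i' → entry (toℕ i ≡ᵇ toℕ i') * pathDeg m (toℕ j) + entry (pathAdj i i'))
      ≡⟨ ∑-+ n _ _ ⟩
    ∑ n (λ i' → entry (toℕ i ≡ᵇ toℕ i') * pathDeg m (toℕ j)) + ∑ n (λ i' → entry (pathAdj i i'))
      ≡⟨ cong₂ _+_ (trans (sym (∑-*ʳ n _ _)) (cong (_* pathDeg m (toℕ j)) (∑-≡ᵇ-count-< n (toℕ i) (Fin.toℕ<n i))))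
                   (∑-pathAdj n i) ⟩
    1 * pathDeg m (toℕ j) + pathDeg n (toℕ i)
      ≡⟨ trans (cong (_+ pathDeg n (toℕ i)) (*-identityˡ (pathDeg m (toℕ j)))) (+-comm (pathDeg m (toℕ j)) _) ⟩
    pathDeg n (toℕ i) + pathDeg m (toℕ j) ∎
    where
      open ≡-Reasoning
      row-sum : ∀ i' → ∑ m (λ j' → entry (gridAdj n m (i , j) (i' , j')))
                      ≡ entry (toℕ i ≡ᵇ toℕ i') * pathDeg m (toℕ j) + entry (pathAdj i i')
      row-sum i' = begin
        ∑ m (λ j' → entry (gridAdj n m (i , j) (i' , j')))
          ≡⟨ trans (∑-cong m (entry-gridAdj i j i')) (∑-+ m _ _) ⟩
        ∑ m (λ j' → entry (toℕ i ≡ᵇ toℕ i') * entry (pathAdj j j')) + ∑ m (λ j' → entry (toℕ j ≡ᵇ toℕ j') * entry (pathAdj i i'))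
          ≡⟨ cong₂ _+_ (sym (∑-*ˡ m (entry (toℕ i ≡ᵇ toℕ i')) _)) (sym (∑-*ʳ m (entry (pathAdj i i')) _)) ⟩
        entry (toℕ i ≡ᵇ toℕ i') * ∑ m (λ j' → entry (pathAdj j j')) + ∑ m (λ j' → entry (toℕ j ≡ᵇ toℕ j')) * entry (pathAdj i i')
          ≡⟨ cong₂ _+_ (cong (entry (toℕ i ≡ᵇ toℕ i') *_) (∑-pathAdj m j))
                       (trans (cong (_* entry (pathAdj i i')) (∑-≡ᵇ-count-< m (toℕ j) (Fin.toℕ<n j))) (*-identityˡ _)) ⟩
        entry (toℕ i ≡ᵇ toℕ i') * pathDeg m (toℕ j) + entry (pathAdj i i') ∎

∑-pathDeg : ∀ k → ∑ k (λ x → pathDeg k (toℕ x)) ≡ (k ∸ 1) + (k ∸ 1)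
∑-pathDeg k = trans (∑-+ k _ _) (cong₂ _+_ (non-first k) (non-last k))
  where
    non-first : ∀ k → ∑ k (λ x → entry (0 <ᵇ toℕ x)) ≡ k ∸ 1
    non-first zero    = refl
    non-first (suc k) = trans (∑-const k 1) (*-identityʳ k)
    below : ∀ k c → ∑ k (λ x → entry (toℕ x <ᵇ c)) ≡ k ⊓ c
    below zero    c       = refl
    below (suc k) zero    = ∑-zero k
    below (suc k) (suc c) = cong suc (below k c)
    non-last : ∀ k → ∑ k (λ x → entry (suc (toℕ x) <ᵇ k)) ≡ k ∸ 1
    non-last zero    = refl
    non-last (suc k) = trans (below (suc k) k) (m≥n⇒m⊓n≡n (n≤1+n k))

∑deg-Grid : ∀ n m → ∑V n m (deg (Grid n m)) ≡ m * ((n ∸ 1) + (n ∸ 1)) + n * ((m ∸ 1) + (m ∸ 1))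
∑deg-Grid n m = begin
  ∑ n (λ i → ∑ m (λ j → deg (Grid n m) (i , j)))
    ≡⟨ ∑-cong n (λ i → trans (∑-cong m (deg-Grid i)) (∑-+ m _ _)) ⟩
  ∑ n (λ i → ∑ m (λ _ → pathDeg n (toℕ i)) + ∑ m (λ j → pathDeg m (toℕ j)))
    ≡⟨ ∑-+ n _ _ ⟩
  ∑ n (λ i → ∑ m (λ _ → pathDeg n (toℕ i))) + ∑ n (λ _ → ∑ m (λ j → pathDeg m (toℕ j)))
    ≡⟨ cong₂ _+_ (trans (∑-cong n (λ i → ∑-const m _)) (sym (∑-*ˡ n m _))) (∑-const n _) ⟩
  m * ∑ n (λ i → pathDeg n (toℕ i)) + n * ∑ m (λ j → pathDeg m (toℕ j))
    ≡⟨ cong₂ _+_ (cong (m *_) (∑-pathDeg n)) (cong (n *_) (∑-pathDeg m)) ⟩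
  m * ((n ∸ 1) + (n ∸ 1)) + n * ((m ∸ 1) + (m ∸ 1)) ∎
  where open ≡-Reasoning

module _ {k : ℕ} where

  toℕ-opposite-+ : (a : Fin k) → toℕ (opposite a) + suc (toℕ a) ≡ k
  toℕ-opposite-+ a = trans (cong (_+ suc (toℕ a)) (Fin.opposite-prop a)) (m∸n+n≡m (Fin.toℕ<n a))

  opposite-≡ᵇ : (a b : Fin k) → (toℕ (opposite a) ≡ᵇ toℕ (opposite b)) ≡ (toℕ a ≡ᵇ toℕ b)
  opposite-≡ᵇ a b = does-⇔ (mk⇔ to from) (toℕ (opposite a) ≟ toℕ (opposite b)) (toℕ a ≟ toℕ b)
    where
      to : toℕ (opposite a) ≡ toℕ (opposite b) → toℕ a ≡ toℕ b
      to oa≡ob = suc-injective (+-cancelˡ-≡ (toℕ (opposite a)) _ _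
        (trans (toℕ-opposite-+ a) (trans (sym (toℕ-opposite-+ b)) (cong (_+ suc (toℕ b)) (sym oa≡ob)))))
      from : toℕ a ≡ toℕ b → toℕ (opposite a) ≡ toℕ (opposite b)
      from a≡b = cong (toℕ ∘ opposite) (Fin.toℕ-injective a≡b)

  opposite-suc-≡ᵇ : (a b : Fin k) → (suc (toℕ (opposite a)) ≡ᵇ toℕ (opposite b)) ≡ (suc (toℕ b) ≡ᵇ toℕ a)
  opposite-suc-≡ᵇ a b = does-⇔ (mk⇔ to from) (suc (toℕ (opposite a)) ≟ toℕ (opposite b)) (suc (toℕ b) ≟ toℕ a)
    where
      oa ob : ℕ
      oa = toℕ (opposite a)
      ob = toℕ (opposite b)
      to : suc oa ≡ ob → suc (toℕ b) ≡ toℕ a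
      to 1+oa≡ob = sym (suc-injective (+-cancelˡ-≡ oa _ _ (begin
        oa + suc (toℕ a)               ≡⟨ toℕ-opposite-+ a ⟩
        k                              ≡⟨ toℕ-opposite-+ b ⟨
        ob + suc (toℕ b)               ≡⟨ cong (_+ suc (toℕ b)) 1+oa≡ob ⟨
        suc oa + suc (toℕ b)           ≡⟨ +-suc oa (suc (toℕ b)) ⟨
        oa + suc (suc (toℕ b))         ∎)))
        where open ≡-Reasoning
      from : suc (toℕ b) ≡ toℕ a → suc oa ≡ ob
      from 1+b≡a = +-cancelʳ-≡ (suc (toℕ b)) _ _ (begin
        suc oa + suc (toℕ b)           ≡⟨ +-suc oa (suc (toℕ b)) ⟨
        oa + suc (suc (toℕ b))         ≡⟨ cong (λ x → oa + suc x) 1+b≡a ⟩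
        oa + suc (toℕ a)               ≡⟨ toℕ-opposite-+ a ⟩
        k                              ≡⟨ toℕ-opposite-+ b ⟨
        ob + suc (toℕ b)               ∎)
        where open ≡-Reasoning

  pathAdj-opposite : (a b : Fin k) → pathAdj (opposite a) (opposite b) ≡ pathAdj a b
  pathAdj-opposite a b =
    trans (cong₂ _∨_ (opposite-suc-≡ᵇ a b) (opposite-suc-≡ᵇ b a)) (∨-comm (suc (toℕ b) ≡ᵇ toℕ a) _)

  -- A vertex fixed by the reflection of P_k would be a middle vertex, which only exists for odd k.
  opposite-≢ : Even k → (a : Fin k) → toℕ (opposite a) ≢ toℕ a
  opposite-≢ (t , k≡t+t) a oa≡a = even≢odd′ t (toℕ a) (trans (sym k≡t+t) (begin
    k                              ≡⟨ toℕ-opposite-+ a ⟨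
    toℕ (opposite a) + suc (toℕ a) ≡⟨ cong (_+ suc (toℕ a)) oa≡a ⟩
    toℕ a + suc (toℕ a)            ≡⟨ +-suc (toℕ a) (toℕ a) ⟩
    suc (toℕ a + toℕ a)            ∎))
    where open ≡-Reasoning

grid-antipodal : ∀ {n m} → Even n → Even m → FreeInvolution (Grid n m)
grid-antipodal {n} {m} even-n even-m = record
  { σ                  = λ { (i , j) → opposite i , opposite j }
  ; σ-involutive       = λ { (i , j) → cong₂ _,_ (Fin.opposite-involutive i) (Fin.opposite-involutive j) }
  ; σ-fixed-point-free = λ { (i , j) eq → opposite-≢ even-n i (cong (toℕ ∘ proj₁) eq) }
  ; σ-automorphism     = automorphism
  ; σ-nonadjacent      = nonadjacent
  }
  where
    automorphism : ∀ u v →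
      gridAdj n m (opposite (proj₁ u) , opposite (proj₂ u)) (opposite (proj₁ v) , opposite (proj₂ v)) ≡ gridAdj n m u v
    automorphism (i , j) (i' , j')
      rewrite opposite-≡ᵇ i i' | opposite-≡ᵇ j j' | pathAdj-opposite i i' | pathAdj-opposite j j' = refl
    nonadjacent : ∀ u → gridAdj n m u (opposite (proj₁ u) , opposite (proj₂ u)) ≡ false
    nonadjacent (i , j)
      rewrite ≢⇒≡ᵇ≡false (opposite-≢ even-n i ∘ sym) | ≢⇒≡ᵇ≡false (opposite-≢ even-m j ∘ sym) = refl

transpose : ∀ {n m} → Vtx m n → Vtx n m
transpose (j , i) = i , j

transposeGraph : ∀ {n m} → SimpleGraph (Vtx n m) → SimpleGraph (Vtx m n)
transposeGraph G = record
  { adj    = λ x y → adj G (transpose x) (transpose y)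
  ; sym    = λ x y → SimpleGraph.sym G (transpose x) (transpose y)
  ; irrefl = λ x → irrefl G (transpose x)
  }

factorable-transpose : ∀ n m → Factorable n m (gridAdj n m) → Factorable m n (gridAdj m n)
factorable-transpose n m (H , K , G=HK) = transposeGraph H , transposeGraph K , λ x y → begin
  entry (gridAdj m n x y)
    ≡⟨ cong entry (∨-comm ((toℕ (proj₁ x) ≡ᵇ toℕ (proj₁ y)) ∧ pathAdj (proj₂ x) (proj₂ y)) _) ⟩
  entry (gridAdj n m (transpose x) (transpose y))
    ≡⟨ G=HK (transpose x) (transpose y) ⟩
  ∑V n m (λ w → A H (transpose x) w * A K w (transpose y))
    ≡⟨ ∑-swap n m (λ i j → A H (transpose x) (i , j) * A K (i , j) (transpose y)) ⟩
  ∑V m n (λ w → A H (transpose x) (transpose w) * A K (transpose w) (transpose y)) ∎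
  where open ≡-Reasoning

-- Degree splittings of grids and paths

grid-connected : ∀ {n m} (P : Vtx (suc n) (suc m) → Set) →
  (∀ {u v} → gridAdj (suc n) (suc m) u v ≡ true → P u → P v) → P (zero , zero) → ∀ u → P u
grid-connected {n} P step P₀₀ (i , j) = <-weakInduction (λ i → ∀ j → P (i , j)) first-row down i j
  where
    first-row : ∀ j → P (zero , j)
    first-row = <-weakInduction (λ j → P (zero , j)) P₀₀ (λ j → step (gridAdj-right {suc n} zero j))
    down : ∀ i → (∀ j → P (inject₁ i , j)) → ∀ j → P (suc i , j)
    down i row j = step (gridAdj-down i j) (row j)

module GridDichotomy {n m : ℕ} (1≤n : 1 ≤ n) (1≤m : 1 ≤ m) {h k : Vtx (suc n) (suc m) → ℕ}
  (S : DegreeSplitting (Grid (suc n) (suc m)) h k) where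
  open DegreeSplitting S

  G : SimpleGraph (Vtx (suc n) (suc m))
  G = Grid (suc n) (suc m)

  deg-≤4 : ∀ u → deg G u ≤ 4
  deg-≤4 (i , j) =
    subst (_≤ 4) (sym (deg-Grid i j)) (+-mono-≤ (pathDeg-≤2 (suc n) (toℕ i)) (pathDeg-≤2 (suc m) (toℕ j)))

  deg-≥1+pathDeg : ∀ i j → 1 + pathDeg (suc m) (toℕ j) ≤ deg G (i , j)
  deg-≥1+pathDeg i j = subst (1 + pathDeg (suc m) (toℕ j) ≤_) (sym (deg-Grid i j))
    (+-monoˡ-≤ _ (pathDeg-≥1 (toℕ i) (s≤s 1≤n) (Fin.toℕ<n i)))

  deg-≥2 : ∀ u → 2 ≤ deg G u
  deg-≥2 (i , j) = ≤-trans (s≤s (pathDeg-≥1 (toℕ j) (s≤s 1≤m) (Fin.toℕ<n j))) (deg-≥1+pathDeg i j)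

  hk-≥2 : ∀ u → 2 ≤ h u * k u
  hk-≥2 u = subst (2 ≤_) (deg≡h*k u) (deg-≥2 u)

  InteriorColumn : Fin (suc m) → Set
  InteriorColumn j = 0 < toℕ j × suc (toℕ j) < suc m

  -- A vertex with h = k = 2 in an interior column passes this property to the vertex
  -- above it, and so up to the first row, where the degree is 3 rather than 4.
  no-double-in-column : ∀ {j} → InteriorColumn j → ∀ i → ¬ (h (i , j) ≡ 2 × k (i , j) ≡ 2)
  no-double-in-column {j} (0<j , j<m-1) = <-weakInduction (λ i → ¬ (h (i , j) ≡ 2 × k (i , j) ≡ 2)) first-row up
    where
      first-row : ¬ (h (zero , j) ≡ 2 × k (zero , j) ≡ 2)
      first-row (h≡2 , k≡2) = case begin
          3                                        ≡⟨ cong₂ _+_ (pathDeg-first (s≤s 1≤n)) (pathDeg-interior 0<j j<m-1) ⟨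
          pathDeg (suc n) 0 + pathDeg (suc m) (toℕ j) ≡⟨ deg-Grid {suc n} zero j ⟨
          deg G (zero , j)                         ≡⟨ deg≡h*k (zero , j) ⟩
          h (zero , j) * k (zero , j)              ≡⟨ cong₂ _*_ h≡2 k≡2 ⟩
          4                                        ∎ of λ ()
        where open ≡-Reasoning
      up : ∀ i → ¬ (h (inject₁ i , j) ≡ 2 × k (inject₁ i , j) ≡ 2) → ¬ (h (suc i , j) ≡ 2 × k (suc i , j) ≡ 2)
      up i ¬double-above (h≡2 , k≡2) = ¬double-above (≤2∧≤2∧3≤*⇒≡2 h-above≤2 k-above≤2 3≤deg-above)
        where
          above below : Vtx (suc n) (suc m)
          above = inject₁ i , j
          below = suc i , j
          above-below : gridAdj (suc n) (suc m) above below ≡ true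
          above-below = gridAdj-down i j
          k-above≤2 : k above ≤ 2
          k-above≤2 = let y , deg-y = edge-deg above-below in
            *≤4⇒≤2 (s≤s (s≤s z≤n))
              (subst (_≤ 4) (trans deg-y (trans (cong (_* k above) h≡2) (*-comm 2 (k above)))) (deg-≤4 y))
          h-above≤2 : h above ≤ 2
          h-above≤2 = let y , deg-y = edge-deg (trans (SimpleGraph.sym G below above) above-below) in
            *≤4⇒≤2 (s≤s (s≤s z≤n)) (subst (_≤ 4) (trans deg-y (cong (h above *_) k≡2)) (deg-≤4 y))
          3≤deg-above : 3 ≤ h above * k above
          3≤deg-above = subst (3 ≤_) (deg≡h*k above)
            (subst (λ d → 1 + d ≤ deg G above) (pathDeg-interior 0<j j<m-1) (deg-≥1+pathDeg (inject₁ i) j))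

  -- Otherwise h u = k u = 2, so u has degree 4 and lies in an interior column.
  trivial-factor : ∀ u → h u ≡ 1 ⊎ k u ≡ 1
  trivial-factor (i , j) with h (i , j) ≟ 1 | k (i , j) ≟ 1
  ... | yes h≡1 | _       = inj₁ h≡1
  ... | no  _   | yes k≡1 = inj₂ k≡1
  ... | no  h≢1 | no  k≢1 = ⊥-elim (no-double-in-column (pathDeg≡2⇒interior (toℕ j) column-pathDeg≡2) i h≡2×k≡2)
    where
      h≡2×k≡2 : h (i , j) ≡ 2 × k (i , j) ≡ 2
      h≡2×k≡2 = ≢1∧≢1∧*≤4⇒≡2 (≤-trans (s≤s z≤n) (hk-≥2 (i , j))) h≢1 k≢1
                  (subst (_≤ 4) (deg≡h*k (i , j)) (deg-≤4 (i , j)))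
      column-pathDeg≡2 : pathDeg (suc m) (toℕ j) ≡ 2
      column-pathDeg≡2 = +≡4⇒≡2ʳ (pathDeg-≤2 (suc n) (toℕ i)) (pathDeg-≤2 (suc m) (toℕ j))
        (trans (sym (deg-Grid i j)) (trans (deg≡h*k (i , j)) (cong₂ _*_ (proj₁ h≡2×k≡2) (proj₂ h≡2×k≡2))))

  h≡1-spreads : ∀ {u v} → adj G u v ≡ true → h u ≡ 1 → h v ≡ 1
  h≡1-spreads {u} {v} uv h≡1 with trivial-factor v
  ... | inj₁ hv≡1 = hv≡1
  ... | inj₂ kv≡1 = ⊥-elim (<-irrefl refl (begin
      2                      ≤⟨ deg-≥2 (proj₁ witness) ⟩
      deg G (proj₁ witness)  ≡⟨ proj₂ witness ⟩
      h u * k v              ≡⟨ cong₂ _*_ h≡1 kv≡1 ⟩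
      1                      ∎))
    where
      open ≤-Reasoning
      witness : ∃ λ y → deg G y ≡ h u * k v
      witness = edge-deg (trans (SimpleGraph.sym G v u) uv)

  splitting-trivial : (∀ u → h u ≡ 1) ⊎ (∀ u → k u ≡ 1)
  splitting-trivial with h (zero , zero) ≟ 1
  ... | yes h₀₀≡1 = inj₁ (grid-connected (λ u → h u ≡ 1) h≡1-spreads h₀₀≡1)
  ... | no  h₀₀≢1 = inj₂ (λ u → k≡1 u (grid-connected (λ u → h u ≢ 1) h≢1-spreads h₀₀≢1 u))
    where
      h≢1-spreads : ∀ {u v} → adj G u v ≡ true → h u ≢ 1 → h v ≢ 1
      h≢1-spreads {u} {v} uv hu≢1 = hu≢1 ∘ h≡1-spreads (trans (SimpleGraph.sym G v u) uv)
      k≡1 : ∀ u → h u ≢ 1 → k u ≡ 1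
      k≡1 u hu≢1 with trivial-factor u
      ... | inj₁ hu≡1 = ⊥-elim (hu≢1 hu≡1)
      ... | inj₂ ku≡1 = ku≡1

grid-splitting-trivial : ∀ {n m h k} → 2 ≤ n → 2 ≤ m → DegreeSplitting (Grid n m) h k →
  (∀ u → h u ≡ 1) ⊎ (∀ u → k u ≡ 1)
grid-splitting-trivial {suc n} {suc m} (s≤s 1≤n) (s≤s 1≤m) S = GridDichotomy.splitting-trivial 1≤n 1≤m S

module LongPathDichotomy {m : ℕ} {h k : Vtx 1 (3 + m) → ℕ} (S : DegreeSplitting (Grid 1 (3 + m)) h k) where
  open DegreeSplitting S

  G : SimpleGraph (Vtx 1 (3 + m))
  G = Grid 1 (3 + m)

  centre : Vtx 1 (3 + m)
  centre = zero , suc zero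

  deg-interior : ∀ (j : Fin (suc m)) → deg G (zero , suc (inject₁ j)) ≡ 2
  deg-interior j = trans (deg-Grid {1} zero (suc (inject₁ j)))
    (pathDeg-interior (s≤s z≤n) (s≤s (s≤s (subst (_< suc m) (sym (Fin.toℕ-inject₁ j)) (Fin.toℕ<n j)))))

  -- Along an edge out of a degree-2 vertex u with h u = 1 (so k u = 2), the edge
  -- gives a vertex of degree h v · 2, while all degrees are at most 2.
  h≡1-spreads : ∀ {u v} → adj G u v ≡ true → deg G u ≡ 2 → h u ≡ 1 → h v ≡ 1
  h≡1-spreads {u} {v} uv deg-u≡2 hu≡1 = ≤-antisym (*-cancelʳ-≤ (h v) 1 2 hv*2≤2) 1≤hv
    where
      deg-≤2 : ∀ y → deg G y ≤ 2
      deg-≤2 (zero , j) = subst (_≤ 2) (sym (deg-Grid {1} zero j)) (pathDeg-≤2 (3 + m) (toℕ j))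
      ku≡2 : k u ≡ 2
      ku≡2 = trans (sym (+-identityʳ (k u))) (trans (cong (_* k u) (sym hu≡1)) (trans (sym (deg≡h*k u)) deg-u≡2))
      hv*2≤2 : h v * 2 ≤ 2
      hv*2≤2 = let y , deg-y = edge-deg uv in subst (_≤ 2) (trans deg-y (cong (h v *_) ku≡2)) (deg-≤2 y)
      1≤hv : 1 ≤ h v
      1≤hv = 0<*⇒0<ˡ (h v) (k v) (subst (0 <_) (deg≡h*k v) (deg-≥1 v))
        where
          deg-≥1 : ∀ y → 1 ≤ deg G y
          deg-≥1 (zero , j) =
            subst (1 ≤_) (sym (deg-Grid {1} zero j)) (pathDeg-≥1 (toℕ j) (s≤s (s≤s z≤n)) (Fin.toℕ<n j))

  centre⇒everywhere : h centre ≡ 1 → ∀ u → h u ≡ 1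
  centre⇒everywhere h-centre (zero , zero) = h≡1-spreads centre-first (deg-interior zero) h-centre
    where
      centre-first : gridAdj 1 (3 + m) centre (zero , zero) ≡ true
      centre-first = trans (gridAdj-sym 1 (3 + m) centre (zero , zero)) (gridAdj-right {1} {2 + m} zero zero)
  centre⇒everywhere h-centre (zero , suc j) = <-weakInduction (λ j → h (zero , suc j) ≡ 1) h-centre
    (λ j → h≡1-spreads (gridAdj-right {1} zero (suc j)) (deg-interior j)) j

path-splitting-trivial : ∀ {m h k} → 2 ≤ m → DegreeSplitting (Grid 1 m) h k →
  (∀ u → h u ≡ 1) ⊎ (∀ u → k u ≡ 1)
path-splitting-trivial {1} (s≤s ()) S
path-splitting-trivial {2} {h} {k} _ S = inj₁ h≡1
  where
    h≡1 : ∀ u → h u ≡ 1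
    h≡1 (zero , zero)     = m*n≡1⇒m≡1 _ _ (sym (DegreeSplitting.deg≡h*k S (zero , zero)))
    h≡1 (zero , suc zero) = m*n≡1⇒m≡1 _ _ (sym (DegreeSplitting.deg≡h*k S (zero , suc zero)))
path-splitting-trivial {suc (suc (suc m))} {h} {k} _ S
  with *≡2⇒factor≡1 (h (zero , suc zero)) (k (zero , suc zero))
         (trans (sym (DegreeSplitting.deg≡h*k S (zero , suc zero))) (LongPathDichotomy.deg-interior S zero))
... | inj₁ h-centre = inj₁ (LongPathDichotomy.centre⇒everywhere S h-centre)
... | inj₂ k-centre = inj₂ (LongPathDichotomy.centre⇒everywhere (DegreeSplitting-swap S) k-centre)

-- The shapes treated directly; n ≥ 2, m = 1 reduces to n = 1 by transposition.
GridShape : ℕ → ℕ → Set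
GridShape n m = (2 ≤ n × 2 ≤ m) ⊎ (n ≡ 1 × 2 ≤ m)

GridShape⇒positive : ∀ {n m} → GridShape n m → 1 ≤ n × 1 ≤ m
GridShape⇒positive (inj₁ (2≤n , 2≤m))  = ≤-trans (s≤s z≤n) 2≤n , ≤-trans (s≤s z≤n) 2≤m
GridShape⇒positive (inj₂ (refl , 2≤m)) = s≤s z≤n , ≤-trans (s≤s z≤n) 2≤m

splitting-trivial : ∀ {n m h k} → GridShape n m → DegreeSplitting (Grid n m) h k →
  (∀ u → h u ≡ 1) ⊎ (∀ u → k u ≡ 1)
splitting-trivial (inj₁ (2≤n , 2≤m))  = grid-splitting-trivial 2≤n 2≤m
splitting-trivial (inj₂ (refl , 2≤m)) = path-splitting-trivial 2≤m

factorable-grid⇒free-involution : ∀ {n m} → GridShape n m → Factorable n m (gridAdj n m) → FreeInvolution (Grid n m)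
factorable-grid⇒free-involution {n} {m} shape (H , K , entries) =
  [ matching-factor⇒free-involution G=HK , matching-factor⇒free-involution (IsProduct-swap G=HK) ]′
    (splitting-trivial shape (product⇒splitting G=HK))
  where
    G=HK : IsProduct (Grid n m) H K
    G=HK = product entries

factorable-grid⇒even-sides : ∀ {n m} → GridShape n m → Factorable n m (gridAdj n m) → Even n × Even m
factorable-grid⇒even-sides {n} {m} shape F =
  grid-parity 1≤n 1≤m even-order (subst (4 ∣_) (∑deg-Grid n m) four-∣-∑deg)
  where
    open FreeInvolutionProperties (factorable-grid⇒free-involution shape F)
    1≤n : 1 ≤ n
    1≤n = proj₁ (GridShape⇒positive shape)
    1≤m : 1 ≤ m
    1≤m = proj₂ (GridShape⇒positive shape)

mainTheorem3 : (m n : ℕ) → m ≥ 1 → n ≥ 1 → ¬ (m ≡ 1 × n ≡ 1) →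
    Factorable n m (gridAdj n m) ⇔ (Even m × Even n)
mainTheorem3 m n 1≤m 1≤n not-both-1 = mk⇔ to from
  where
    to : Factorable n m (gridAdj n m) → Even m × Even n
    to F with n ≟ 1 | m ≟ 1
    ... | yes refl | yes refl = ⊥-elim (not-both-1 (refl , refl))
    ... | yes refl | no  m≢1  = swap (factorable-grid⇒even-sides (inj₂ (refl , ≢1⇒≥2 1≤m m≢1)) F)
    ... | no  n≢1  | yes refl = factorable-grid⇒even-sides (inj₂ (refl , ≢1⇒≥2 1≤n n≢1)) (factorable-transpose n 1 F)
    ... | no  n≢1  | no  m≢1  = swap (factorable-grid⇒even-sides (inj₁ (≢1⇒≥2 1≤n n≢1 , ≢1⇒≥2 1≤m m≢1)) F)
    from : Even m × Even n → Factorable n m (gridAdj n m)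
    from (even-m , even-n) = free-involution⇒factorable (grid-antipodal even-n even-m)
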